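{- Let $G$ be a graph such that every equivalence class of the relation $\sim_G$ has at least two elements. Then $0\in spec(G,A)$ for every abelian group $A$ with $|A|>2$.
   Context: For vertices $u,v$ of $G$, $u\sim_G v$ iff $N_G(u)=N_G(v)$ (equal open neighbourhoods); this is an equivalence relation. For an additive abelian group $A$ with identity $0$, an $A$-vertex magic labeling of $G$ is a map $l:V(G)\to A\setminus\{0\}$ with $\sum_{u\in N_G(v)} l(u)=\mu$ for all $v$, for some fixed $\mu\in A$ (the magic constant); $spec(G,A)$ is the set of all such magic constants. -}

module Defs where

open import Level using (Level)
open import Data.Nat using (ℕ; zero; suc)
open import Data.Fin using (Fin; zero; suc)
open import Data.Bool using (Bool; true; false; if_then_else_)
open import Data.Product using (Σ; ∃; _×_; _,_)
open import Relation.Binary.PropositionalEquality using (_≡_)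
open import Relation.Nullary using (¬_)
open import Algebra.Bundles using (AbelianGroup)

record Graph (n : ℕ) : Set where
  field
    adj   : Fin n → Fin n → Bool
    sym   : ∀ u v → adj u v ≡ adj v u
    irrfl : ∀ v → adj v v ≡ false
open Graph public

_∼⟨_⟩_ : ∀ {n} → Fin n → Graph n → Fin n → Set
u ∼⟨ G ⟩ v = ∀ w → adj G u w ≡ adj G v w

module _ {c ℓ : Level} (A : AbelianGroup c ℓ) where
  open AbelianGroup A

  sumFin : ∀ {n} → (Fin n → Carrier) → Carrier
  sumFin {zero}  f = ε
  sumFin {suc n} f = f zero ∙ sumFin (λ i → f (suc i))

  nbhdSum : ∀ {n} → Graph n → (Fin n → Carrier) → Fin n → Carrier
  nbhdSum G l v = sumFin (λ u → if adj G v u then l u else ε)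

  IsVertexMagic : ∀ {n} → Graph n → (Fin n → Carrier) → Carrier → Set ℓ
  IsVertexMagic G l μ = (∀ v → ¬ (l v ≈ ε)) × (∀ v → nbhdSum G l v ≈ μ)

  InSpec : ∀ {n} → Graph n → Carrier → Set (c Level.⊔ ℓ)
  InSpec {n} G μ = Σ (Fin n → Carrier) (λ l → IsVertexMagic G l μ)

{-# OPTIONS --safe #-}
module Submission where

-- Vertices of one ∼-class have the same neighbourhood, so every neighbourhood is a
-- union of ∼-classes and it suffices to label each class, of size k ≥ 2, by nonzero
-- elements summing to 0. Given pairwise distinct a, b, d, walk s₀ = a, s₁, …, sₖ = a
-- with the interior coloured alternately by b and d; consecutive colours differ, so
-- the labels sᵢ - sᵢ₊₁ are nonzero, and they telescope to s₀ - sₖ = 0.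

open import Defs hiding (sym)
open import Algebra.Bundles using (CommutativeMonoid; Group; AbelianGroup)
import Algebra.Properties.Monoid.Sum as MonoidSum
open import Data.Bool.Base using (Bool; true; false; if_then_else_)
import Data.Bool.Properties as Bool
open import Data.Fin.Base as Fin using (Fin; zero; suc)
import Data.Fin.Properties as Fin
open import Data.Nat.Base as ℕ using (ℕ; zero; suc; _≤_; z≤n; s≤s)
import Data.Nat.Properties as ℕ
open import Data.Product.Base using (∃; _×_; _,_; proj₁; proj₂)
open import Function.Base using (_∘_)
open import Level using (Level)
open import Relation.Binary.Bundles using (Setoid)
open import Relation.Binary.Core using (Rel)
open import Relation.Binary.Structures using (IsDecEquivalence)
open import Relation.Binary.PropositionalEquality as ≡ using (_≡_; _≢_; _≗_)
open import Relation.Nullary.Decidable using (yes; no; does; dec-true)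
open import Relation.Nullary.Negation using (¬_; contradiction)
open import Relation.Unary using (Pred; Decidable)

Least : ∀ {n p} → Pred (Fin n) p → Pred (Fin n) p
Least P i = P i × (∀ j → P j → i Fin.≤ j)

least : ∀ {n p} {P : Pred (Fin n) p} → Decidable P → ∃ P → ∃ (Least P)
least {zero}  P? (() , _)
least {suc n} P? (i , Pi) with P? zero
... | yes P0 = zero , P0 , λ _ _ → z≤n
least {suc n} P? (zero , P0)  | no ¬P0 = contradiction P0 ¬P0
least {suc n} P? (suc i , Pi) | no ¬P0 with least (P? ∘ suc) (i , Pi)
... | j , Pj , j-least = suc j , Pj , λ where
  zero    P0 → contradiction P0 ¬P0
  (suc k) Pk → s≤s (j-least k Pk)

Least-unique : ∀ {n p q} {P : Pred (Fin n) p} {Q : Pred (Fin n) q} {i j} →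
               (∀ k → P k → Q k) → (∀ k → Q k → P k) →
               Least P i → Least Q j → i ≡ j
Least-unique P⇒Q Q⇒P (Pi , i-least) (Qj , j-least) =
  Fin.≤-antisym (i-least _ (Q⇒P _ Qj)) (j-least _ (P⇒Q _ Pi))

module Representative {n ℓ} {_≈_ : Rel (Fin n) ℓ}
                      (isDecEquivalence : IsDecEquivalence _≈_) where
  open IsDecEquivalence isDecEquivalence
    using (_≟_) renaming (refl to ≈-refl; sym to ≈-sym; trans to ≈-trans)

  private
    leastRelated : ∀ u → ∃ (Least (u ≈_))
    leastRelated u = least (u ≟_) (u , ≈-refl)

  rep : Fin n → Fin n
  rep u = proj₁ (leastRelated u)

  rep-related : ∀ u → u ≈ rep u
  rep-related u = proj₁ (proj₂ (leastRelated u))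

  rep-cong : ∀ {u v} → u ≈ v → rep u ≡ rep v
  rep-cong u≈v = Least-unique (λ _ → ≈-trans (≈-sym u≈v)) (λ _ → ≈-trans u≈v)
                              (proj₂ (leastRelated _)) (proj₂ (leastRelated _))

count : ∀ {n} → (Fin n → Bool) → ℕ
count {zero}  p = 0
count {suc n} p = if p zero then suc (count (p ∘ suc)) else count (p ∘ suc)

rank : ∀ {n} → (Fin n → Bool) → Fin n → ℕ
rank p zero    = 0
rank p (suc i) = if p zero then suc (rank (p ∘ suc) i) else rank (p ∘ suc) i

count-tail≤count : ∀ {n} (p : Fin (suc n) → Bool) → count (p ∘ suc) ≤ count p
count-tail≤count p with p zero
... | true  = ℕ.n≤1+n _
... | false = ℕ.≤-refl

1≤count : ∀ {n} (p : Fin n → Bool) {i} → p i ≡ true → 1 ≤ count p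
1≤count p {zero}  pi rewrite pi = s≤s z≤n
1≤count p {suc i} pi = ℕ.≤-trans (1≤count (p ∘ suc) pi) (count-tail≤count p)

2≤count : ∀ {n} (p : Fin n → Bool) {i j} → i ≢ j → p i ≡ true → p j ≡ true → 2 ≤ count p
2≤count p {zero}  {zero}  i≢j _  _  = contradiction ≡.refl i≢j
2≤count p {zero}  {suc j} _   pi pj rewrite pi = s≤s (1≤count (p ∘ suc) pj)
2≤count p {suc i} {zero}  _   pi pj rewrite pj = s≤s (1≤count (p ∘ suc) pi)
2≤count p {suc i} {suc j} i≢j pi pj =
  ℕ.≤-trans (2≤count (p ∘ suc) (i≢j ∘ ≡.cong suc) pi pj) (count-tail≤count p)

fibre : ∀ {n m} → (Fin n → Fin m) → Fin m → Fin n → Bool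
fibre key w u = does (key u Fin.≟ w)

module FibreSums {c ℓ} (M : CommutativeMonoid c ℓ) where
  open CommutativeMonoid M
  open import Algebra.Properties.CommutativeMonoid.Sum M

  ∑-zero : ∀ {n} {f : Fin n → Carrier} → (∀ i → f i ≈ ε) → ∑[ i < n ] f i ≈ ε
  ∑-zero {n} f≈ε = trans (sum-cong-≋ f≈ε) (sum-replicate-zero n)

  ∑-if : ∀ {n} b (f : Fin n → Carrier) →
         ∑[ i < n ] (if b then f i else ε) ≈ (if b then sum f else ε)
  ∑-if     true  f = refl
  ∑-if {n} false f = sum-replicate-zero n

  ∑-indicator : ∀ {m} (i : Fin m) x → ∑[ j < m ] (if does (i Fin.≟ j) then x else ε) ≈ x
  ∑-indicator {suc m} zero x = trans (∙-congˡ (sum-replicate-zero m)) (identityʳ x)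
  ∑-indicator (suc i)  x = trans (identityˡ _) (∑-indicator i x)

  module _ {n m} (key : Fin n → Fin m) where

    ∑-fibres : ∀ (f : Fin n → Carrier) → sum f ≈ ∑[ w < m ] ∑[ u < n ] (if fibre key w u then f u else ε)
    ∑-fibres f = trans (sum-cong-≋ (λ u → sym (∑-indicator (key u) (f u))))
                       (∑-comm (λ u w → if fibre key w u then f u else ε))

    fibre-if : ∀ p q → p ≗ q ∘ key → ∀ (f : Fin n → Carrier) w u →
               (if fibre key w u then (if p u then f u else ε) else ε)
               ≡ (if q w then (if fibre key w u then f u else ε) else ε)
    fibre-if p q p≗q∘key f w u with key u Fin.≟ w
    ... | yes keyu≡w = ≡.cong (λ b → if b then f u else ε) (≡.trans (p≗q∘key u) (≡.cong q keyu≡w))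
    ... | no _       = ≡.sym (Bool.if-eta (q w))

    ∑-if-vanishes : ∀ p q → p ≗ q ∘ key → ∀ (f : Fin n → Carrier) →
                    (∀ w → ∑[ u < n ] (if fibre key w u then f u else ε) ≈ ε) →
                    ∑[ u < n ] (if p u then f u else ε) ≈ ε
    ∑-if-vanishes p q p≗q∘key f fibreSum≈ε =
      trans (∑-fibres _) (∑-zero λ w →
        trans (reflexive (sum-cong-≗ (fibre-if p q p≗q∘key f w)))
              (trans (∑-if (q w) (λ u → if fibre key w u then f u else ε))
                     (if-vanishes (q w) (fibreSum≈ε w))))
      where
      if-vanishes : ∀ b {x} → x ≈ ε → (if b then x else ε) ≈ ε
      if-vanishes true  x≈ε = x≈ε
      if-vanishes false _   = refl

module Telescoping {c ℓ} (G : Group c ℓ) where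
  open Group G
  open import Algebra.Properties.Monoid.Sum monoid
  open import Relation.Binary.Reasoning.Setoid setoid

  ∙⁻¹-cancel : ∀ x y z → (x ∙ y ⁻¹) ∙ (y ∙ z ⁻¹) ≈ x ∙ z ⁻¹
  ∙⁻¹-cancel x y z = begin
    (x ∙ y ⁻¹) ∙ (y ∙ z ⁻¹) ≈⟨ assoc x (y ⁻¹) (y ∙ z ⁻¹) ⟩
    x ∙ (y ⁻¹ ∙ (y ∙ z ⁻¹)) ≈⟨ ∙-congˡ (assoc (y ⁻¹) y (z ⁻¹)) ⟨
    x ∙ ((y ⁻¹ ∙ y) ∙ z ⁻¹) ≈⟨ ∙-congˡ (∙-congʳ (inverseˡ y)) ⟩
    x ∙ (ε ∙ z ⁻¹)          ≈⟨ ∙-congˡ (identityˡ (z ⁻¹)) ⟩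
    x ∙ z ⁻¹                ∎

  ∑-telescope-rank : ∀ {n} (p : Fin n → Bool) (s : ℕ → Carrier) →
    ∑[ u < n ] (if p u then s (rank p u) ∙ s (suc (rank p u)) ⁻¹ else ε)
    ≈ s 0 ∙ s (count p) ⁻¹
  ∑-telescope-rank {zero}  p s = sym (inverseʳ (s 0))
  ∑-telescope-rank {suc n} p s with p zero
  ... | true  = trans (∙-congˡ (∑-telescope-rank (p ∘ suc) (s ∘ suc)))
                      (∙⁻¹-cancel (s 0) (s 1) (s (suc (count (p ∘ suc)))))
  ... | false = trans (identityˡ _) (∑-telescope-rank (p ∘ suc) s)

module ClosedWalkColouring {c ℓ} (S : Setoid c ℓ) (a b d : Setoid.Carrier S)
                           (a≉b : ¬ Setoid._≈_ S a b) (a≉d : ¬ Setoid._≈_ S a d)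
                           (b≉d : ¬ Setoid._≈_ S b d) where
  open Setoid S

  interior : ℕ → Carrier
  interior zero          = d
  interior (suc zero)    = b
  interior (suc (suc i)) = interior i

  interior≉a : ∀ i → ¬ interior i ≈ a
  interior≉a zero          = a≉d ∘ sym
  interior≉a (suc zero)    = a≉b ∘ sym
  interior≉a (suc (suc i)) = interior≉a i

  interior-proper : ∀ i → ¬ interior i ≈ interior (suc i)
  interior-proper zero          = b≉d ∘ sym
  interior-proper (suc zero)    = b≉d
  interior-proper (suc (suc i)) = interior-proper i

  colour : ℕ → ℕ → Carrier
  colour K zero    = a
  colour K (suc i) with suc i ℕ.≟ K
  ... | yes _ = a
  ... | no _  = interior (suc i)

  colour-closed : ∀ K → colour K K ≡ colour K 0
  colour-closed zero = ≡.refl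
  colour-closed (suc k) with suc k ℕ.≟ suc k
  ... | yes _     = ≡.refl
  ... | no k+1≢k+1 = contradiction ≡.refl k+1≢k+1

  colour-proper : ∀ {K} → 2 ≤ K → ∀ i → ¬ colour K i ≈ colour K (suc i)
  colour-proper (s≤s (s≤s _)) zero = a≉b
  colour-proper {K} _ (suc i) with suc i ℕ.≟ K | suc (suc i) ℕ.≟ K
  ... | yes ≡.refl | yes 2+i≡1+i = contradiction 2+i≡1+i ℕ.1+n≢n
  ... | yes _      | no _        = interior≉a (suc (suc i)) ∘ sym
  ... | no _       | yes _       = interior≉a (suc i)
  ... | no _       | no _        = interior-proper (suc i)

module ZeroSumLabelling {c ℓ} (G : Group c ℓ) (a b d : Group.Carrier G)
                        (a≉b : ¬ Group._≈_ G a b) (a≉d : ¬ Group._≈_ G a d)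
                        (b≉d : ¬ Group._≈_ G b d) where
  open Group G
  open import Algebra.Properties.Group G using (x∙y⁻¹≈ε⇒x≈y; x≈y⇒x∙y⁻¹≈ε)
  open import Algebra.Properties.Monoid.Sum monoid
  open ClosedWalkColouring setoid a b d a≉b a≉d b≉d
  open Telescoping G

  -- The i-th member of p (in increasing order) gets the i-th step of the closed walk
  -- of length count p.
  label : ∀ {n} → (Fin n → Bool) → Fin n → Carrier
  label p u = colour (count p) (rank p u) ∙ colour (count p) (suc (rank p u)) ⁻¹

  ∑-label : ∀ {n} (p : Fin n → Bool) → ∑[ u < n ] (if p u then label p u else ε) ≈ ε
  ∑-label p = trans (∑-telescope-rank p (colour (count p)))
                    (x≈y⇒x∙y⁻¹≈ε (reflexive (≡.sym (colour-closed (count p)))))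

  label≉ε : ∀ {n} (p : Fin n → Bool) → 2 ≤ count p → ∀ u → ¬ label p u ≈ ε
  label≉ε p 2≤count u = colour-proper 2≤count (rank p u) ∘ x∙y⁻¹≈ε⇒x≈y _ _

  fibreLabel : ∀ {n m} → (Fin n → Fin m) → Fin n → Carrier
  fibreLabel key u = label (fibre key (key u)) u

  ∑-fibreLabel : ∀ {n m} (key : Fin n → Fin m) w →
                 ∑[ u < n ] (if fibre key w u then fibreLabel key u else ε) ≈ ε
  ∑-fibreLabel key w = trans (reflexive (sum-cong-≗ on-fibre)) (∑-label (fibre key w))
    where
    on-fibre : ∀ u → (if fibre key w u then fibreLabel key u else ε)
                     ≡ (if fibre key w u then label (fibre key w) u else ε)
    on-fibre u with key u Fin.≟ w
    ... | yes keyu≡w = ≡.cong (λ w′ → label (fibre key w′) u) keyu≡w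
    ... | no _       = ≡.refl

  fibreLabel≉ε : ∀ {n m} (key : Fin n → Fin m) {u v} → v ≢ u → key v ≡ key u →
                 ¬ fibreLabel key u ≈ ε
  fibreLabel≉ε key {u} {v} v≢u keyv≡keyu =
    label≉ε _ (2≤count _ v≢u (dec-true (key v Fin.≟ key u) keyv≡keyu)
                              (dec-true (key u Fin.≟ key u) ≡.refl)) u

∼-isDecEquivalence : ∀ {n} (G : Graph n) → IsDecEquivalence (_∼⟨ G ⟩_)
∼-isDecEquivalence G = record
  { isEquivalence = record
    { refl  = λ _ → ≡.refl
    ; sym   = λ u∼v w → ≡.sym (u∼v w)
    ; trans = λ u∼v v∼w w → ≡.trans (u∼v w) (v∼w w)
    }
  ; _≟_ = λ u v → Fin.all? (λ w → adj G u w Bool.≟ adj G v w)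
  }

∼⇒adj≡ : ∀ {n} (G : Graph n) {u u′} → u ∼⟨ G ⟩ u′ → ∀ v → adj G v u ≡ adj G v u′
∼⇒adj≡ G {u} {u′} u∼u′ v = ≡.trans (Graph.sym G v u) (≡.trans (u∼u′ v) (Graph.sym G u′ v))

sumFin≡∑ : ∀ {c ℓ} (A : AbelianGroup c ℓ) {n} (f : Fin n → AbelianGroup.Carrier A) →
           sumFin A f ≡ MonoidSum.sum (AbelianGroup.monoid A) f
sumFin≡∑ A {zero}  f = ≡.refl
sumFin≡∑ A {suc n} f = ≡.cong (AbelianGroup._∙_ A (f zero)) (sumFin≡∑ A (f ∘ suc))

mainTheorem19 : ∀ {n : ℕ} (G : Graph n)
    → (∀ u → ∃ λ v → ¬ (v ≡ u) × (u ∼⟨ G ⟩ v))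
    → ∀ {c ℓ : Level} (A : AbelianGroup c ℓ)
    → (∃ λ a → ∃ λ b → ∃ λ d → ¬ (AbelianGroup._≈_ A a b) × ¬ (AbelianGroup._≈_ A a d) × ¬ (AbelianGroup._≈_ A b d))
    → InSpec A G (AbelianGroup.ε A)
mainTheorem19 G twins A (a , b , d , a≉b , a≉d , b≉d) =
  fibreLabel rep , rep-label≉ε , nbhdSum≈ε
  where
  open AbelianGroup A
  open Representative (∼-isDecEquivalence G)
  open ZeroSumLabelling group a b d a≉b a≉d b≉d
  open FibreSums commutativeMonoid

  rep-label≉ε : ∀ u → ¬ fibreLabel rep u ≈ ε
  rep-label≉ε u with twins u
  ... | v , v≢u , u∼v = fibreLabel≉ε rep v≢u (≡.sym (rep-cong u∼v))

  nbhdSum≈ε : ∀ v → nbhdSum A G (fibreLabel rep) v ≈ ε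
  nbhdSum≈ε v = trans (reflexive (sumFin≡∑ A (λ u → if adj G v u then fibreLabel rep u else ε)))
    (∑-if-vanishes rep (adj G v) (adj G v) (λ u → ∼⇒adj≡ G (rep-related u) v)
                   (fibreLabel rep) (∑-fibreLabel rep))
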